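{- Let $a,b,c$ be positive integers. Let $\mathrm{PP}(a,b,c)$ be the set of plane partitions with at most $b$ nonzero rows, at most $a$ nonzero columns (i.e. first row of the shape of length at most $a$), and all entries at most $c$. Let $\mathrm{BM}(a,b,c)$ be the set of $b\times c$ matrices $D=(d_{i\ell})$ with entries in $\mathbb N=\{0,1,2,\dots\}$ whose last passage time $G(b,c)=\max_\Pi\sum_{(i,\ell)\in\Pi}d_{i\ell}$ satisfies $G(b,c)\le a$, where the maximum is over monotone lattice paths $\Pi$ from $(1,1)$ to $(b,c)$ using steps $(i,\ell)\to(i+1,\ell)$ and $(i,\ell)\to(i,\ell+1)$. Then the map $\Phi$ restricts to a bijection from $\mathrm{PP}(a,b,c)$ onto $\mathrm{BM}(a,b,c)$.
   Context: A plane partition is an array $\pi=(\pi_{ij})_{i,j\ge1}$ of nonnegative integers with finitely many nonzero entries satisfying $\pi_{ij}\ge\pi_{i+1,j}$ and $\pi_{ij}\ge\pi_{i,j+1}$. For a plane partition $\pi$, define $d_{i\ell}=|\{j:\pi_{ij}=\ell>\pi_{i+1,j}\}|$ for $i,\ell\ge1$, and $\Phi(\pi)=(d_{i\ell})_{i,\ell\ge1}$; for $\pi\in\mathrm{PP}(a,b,c)$ this is regarded as a $b\times c$ matrix $(d_{i\ell})_{1\le i\le b,1\le\ell\le c}$. -}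

module Defs where

open import Data.Nat using (ℕ; zero; suc; _+_; _∸_; _≤_; _<_; _<?_)
open import Data.Nat.Properties using (_≟_)
open import Data.Fin using (Fin; toℕ; fromℕ<)
open import Data.List using (List; length; filter; allFin)
open import Data.Product using (_×_; Σ; _,_)
open import Relation.Nullary using (yes; no)
open import Relation.Nullary.Decidable using (_×-dec_)
open import Relation.Binary.PropositionalEquality using (_≡_)

-- Conventions: everything is 0-indexed.  Row index i : Fin b stands for
-- row i+1, column index j : Fin a for column j+1, and value index
-- ℓ : Fin c stands for the value ℓ+1 ∈ {1,…,c}.

-- An array with (at most) b rows and a columns; entries outside the
-- b × a box are 0 (implicitly).
Array : ℕ → ℕ → Set
Array a b = Fin b → Fin a → ℕ

Matrix : ℕ → ℕ → Set
Matrix b c = Fin b → Fin c → ℕ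

-- π ∈ PP(a,b,c): entries ≤ c, weakly decreasing along rows and columns
-- (entries outside the box are 0, so the conditions at the boundary are automatic).
IsPP : (a b c : ℕ) → Array a b → Set
IsPP a b c π =
  (∀ i j → π i j ≤ c)
  × (∀ (i i' : Fin b) (j : Fin a) → toℕ i' ≡ suc (toℕ i) → π i' j ≤ π i j)
  × (∀ (i : Fin b) (j j' : Fin a) → toℕ j' ≡ suc (toℕ j) → π i j' ≤ π i j)

below : (a b : ℕ) → Array a b → Fin b → Fin a → ℕ
below a b π i j with suc (toℕ i) <? b
... | yes p = π (fromℕ< p) j
... | no _ = 0

Φ : (a b c : ℕ) → Array a b → Matrix b c
Φ a b c π i ℓ =
  length (filter (λ j → (π i j ≟ suc (toℕ ℓ)) ×-dec (below a b π i j <? suc (toℕ ℓ)))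
                 (allFin a))

data Path : ℕ → ℕ → Set where
  stop  : Path 0 0
  down  : ∀ {r s} → Path r s → Path (suc r) s
  right : ∀ {r s} → Path r s → Path r (suc s)

weight : ∀ {r s} → (ℕ → ℕ → ℕ) → Path r s → ℕ
weight D stop = D 0 0
weight D (down p) = D 0 0 + weight (λ i l → D (suc i) l) p
weight D (right p) = D 0 0 + weight (λ i l → D i (suc l)) p

ext : (b c : ℕ) → Matrix b c → ℕ → ℕ → ℕ
ext b c D i l with i <? b | l <? c
... | yes p | yes q = D (fromℕ< p) (fromℕ< q)
... | _ | _ = 0

-- Last passage time G(b,c) ≤ a, i.e. every monotone lattice path from
-- (1,1) to (b,c) (0-indexed: (0,0) to (b-1,c-1)) has weight ≤ a.
IsBM : (a b c : ℕ) → Matrix b c → Set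
IsBM a b c D = ∀ (p : Path (b ∸ 1) (c ∸ 1)) → weight (ext b c D) p ≤ a

-- Let W i k = #{j : π i j > k} (levelWidth π); for fixed i, k ↦ W i k is the conjugate of row i,
-- so W determines π.  For consecutive rows f = π i ≥ g = π (i+1), the columns with f j > k contain
-- the two initial segments {g > k} and {f > k+1}, whose union has length W (i+1) k ⊔ W i (k+1);
-- the rest are the columns with f j = k+1 > g j, counted by d_{i,k+1}.  Hence
--   W i k = d_{i,k+1} + (W (i+1) k ⊔ W i (k+1)),
-- the recurrence of last passage times to the corner, so W 0 0 = G(b, c) ≤ a and Φ(π) determines
-- W and thus π.  Conversely the last passage times of any D with G(b, c) ≤ a are antitone and
-- bounded by a, so their row-wise conjugates form a plane partition π with these level widths,
-- and the recurrence forces Φ(π) = D.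
module Submission where

open import Defs
open import Data.Nat using (ℕ; _<_)
open import Data.Fin using (Fin)
open import Data.Product using (_×_; ∃)
open import Relation.Binary.PropositionalEquality using (_≡_)

open import Level using (Level)
open import Data.Nat
  using (zero; suc; _+_; _∸_; _⊔_; _≤_; _≥_; _≤′_; ≤′-refl; ≤′-step; _<?_; z≤n; s≤s; s≤s⁻¹; z<s)
open import Data.Nat.Properties
open import Data.Fin as Fin using (toℕ; fromℕ<)
open import Data.Fin.Properties using (toℕ<n; toℕ-fromℕ<; fromℕ<-toℕ)
open import Data.List using (length; filter; tabulate)
open import Data.Product using (_,_; proj₁; proj₂)
open import Data.Sum as Sum using (_⊎_; inj₁; inj₂; [_,_])
open import Function using (_∘_; _⇔_; mk⇔; Equivalence)
open import Relation.Nullary using (yes; no; does; ¬_; contradiction)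
open import Relation.Nullary.Decidable using (_×-dec_)
open import Relation.Unary using (Pred; Decidable)
open import Relation.Unary.Properties using (_∩?_; _∪?_; ∁?)
open import Relation.Binary using (_Preserves_⟶_; _Respects_)
open import Relation.Binary.PropositionalEquality
  using (refl; sym; trans; cong; cong₂; subst; subst₂; module ≡-Reasoning)

open Equivalence using (to; from)

private
  variable
    p q : Level
    P : Pred ℕ p
    Q : Pred ℕ q
    a b c i j k n : ℕ
    f g : ℕ → ℕ
    E M : ℕ → ℕ → ℕ

-- Counting on {0, …, n-1}

count : ℕ → Decidable P → ℕ
count zero    P? = 0
count (suc n) P? with P? 0
... | yes _ = suc (count n (P? ∘ suc))
... | no  _ = count n (P? ∘ suc)

count-≤ : ∀ n (P? : Decidable P) → count n P? ≤ n
count-≤ zero    P? = z≤n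
count-≤ (suc n) P? with P? 0
... | yes _ = s≤s (count-≤ n (P? ∘ suc))
... | no  _ = m≤n⇒m≤1+n (count-≤ n (P? ∘ suc))

count-mono : ∀ n (P? : Decidable P) (Q? : Decidable Q) →
             (∀ {j} → j < n → P j → Q j) → count n P? ≤ count n Q?
count-mono zero    P? Q? P⊆Q = z≤n
count-mono (suc n) P? Q? P⊆Q with P? 0 | Q? 0
... | yes P0 | no ¬Q0 = contradiction (P⊆Q z<s P0) ¬Q0
... | yes _  | yes _  = s≤s (count-mono n (P? ∘ suc) (Q? ∘ suc) (P⊆Q ∘ s≤s))
... | no  _  | yes _  = m≤n⇒m≤1+n (count-mono n (P? ∘ suc) (Q? ∘ suc) (P⊆Q ∘ s≤s))
... | no  _  | no  _  = count-mono n (P? ∘ suc) (Q? ∘ suc) (P⊆Q ∘ s≤s)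

count-cong : ∀ n (P? : Decidable P) (Q? : Decidable Q) →
             (∀ {j} → j < n → P j ⇔ Q j) → count n P? ≡ count n Q?
count-cong n P? Q? P⇔Q =
  ≤-antisym (count-mono n P? Q? (to ∘ P⇔Q)) (count-mono n Q? P? (from ∘ P⇔Q))

count-none : ∀ n (P? : Decidable P) → (∀ {j} → j < n → ¬ P j) → count n P? ≡ 0
count-none zero    P? none = refl
count-none (suc n) P? none with P? 0
... | yes P0 = contradiction P0 (none z<s)
... | no  _  = count-none n (P? ∘ suc) (none ∘ s≤s)

count-split : ∀ n (P? : Decidable P) (Q? : Decidable Q) →
              count n P? ≡ count n (P? ∩? ∁? Q?) + count n (P? ∩? Q?)
count-split zero    P? Q? = refl
count-split (suc n) P? Q? with P? 0 | Q? 0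
... | yes _ | yes _ = trans (cong suc (count-split n (P? ∘ suc) (Q? ∘ suc))) (sym (+-suc _ _))
... | yes _ | no  _ = cong suc (count-split n (P? ∘ suc) (Q? ∘ suc))
... | no  _ | yes _ = count-split n (P? ∘ suc) (Q? ∘ suc)
... | no  _ | no  _ = count-split n (P? ∘ suc) (Q? ∘ suc)

count-< : ∀ {k n} → k ≤ n → count n (_<? k) ≡ k
count-< {zero}  {n}     _         = count-none n (_<? 0) (λ _ ())
count-< {suc k} {suc n} (s≤s k≤n) = cong suc (trans
  (count-cong n (λ j → suc j <? suc k) (_<? k) (λ _ → mk⇔ s≤s⁻¹ s≤s))
  (count-< k≤n))

count-downClosed : ∀ n (P? : Decidable P) → P Respects _≥_ →
                   ∀ {j} → j < n → j < count n P? ⇔ P j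
count-downClosed zero    P? closed ()
count-downClosed (suc n) P? closed {j} j<n with P? 0
... | no ¬P0 = mk⇔ (λ j<count → contradiction (subst (j <_) none j<count) λ ())
                   (λ Pj → contradiction (closed z≤n Pj) ¬P0)
  where
  none : count n (P? ∘ suc) ≡ 0
  none = count-none n (P? ∘ suc) (λ _ P1+j → ¬P0 (closed z≤n P1+j))
count-downClosed (suc n) P? closed {zero}  j<n | yes P0 = mk⇔ (λ _ → P0) (λ _ → z<s)
count-downClosed {P = P} (suc n) P? closed {suc j} j<n | yes _ =
  mk⇔ (to shifted ∘ s≤s⁻¹) (s≤s ∘ from shifted)
  where
  shifted : j < count n (P? ∘ suc) ⇔ P (suc j)
  shifted = count-downClosed n (P? ∘ suc) (closed ∘ s≤s) (s≤s⁻¹ j<n)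

count-∪ : ∀ n (P? : Decidable P) (Q? : Decidable Q) → P Respects _≥_ → Q Respects _≥_ →
          count n (P? ∪? Q?) ≡ count n P? ⊔ count n Q?
count-∪ {P = P} {Q = Q} n P? Q? P-closed Q-closed = begin
  count n (P? ∪? Q?)      ≡⟨ count-cong n (P? ∪? Q?) (_<? cP ⊔ cQ) union⇔ ⟩
  count n (_<? cP ⊔ cQ)   ≡⟨ count-< (⊔-lub (count-≤ n P?) (count-≤ n Q?)) ⟩
  cP ⊔ cQ                 ∎
  where
  open ≡-Reasoning
  cP cQ : ℕ
  cP = count n P?
  cQ = count n Q?
  <⊔⇒ : ∀ {j} → j < cP ⊔ cQ → j < cP ⊎ j < cQ
  <⊔⇒ {j} lt with ⊔-sel cP cQ
  ... | inj₁ ⊔≡cP = inj₁ (subst (j <_) ⊔≡cP lt)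
  ... | inj₂ ⊔≡cQ = inj₂ (subst (j <_) ⊔≡cQ lt)
  union⇔ : ∀ {j} → j < n → (P j ⊎ Q j) ⇔ j < cP ⊔ cQ
  union⇔ {j} j<n = mk⇔
    [ m<n⇒m<n⊔o cQ ∘ from P⇔ , m<n⇒m<o⊔n cP ∘ from Q⇔ ]
    (Sum.map (to P⇔) (to Q⇔) ∘ <⊔⇒)
    where
    P⇔ : j < cP ⇔ P j
    P⇔ = count-downClosed n P? P-closed j<n
    Q⇔ : j < cQ ⇔ Q j
    Q⇔ = count-downClosed n Q? Q-closed j<n

-- Conjugate partitions

steps⇒antitone : (∀ n → f (suc n) ≤ f n) → f Preserves _≤_ ⟶ _≥_
steps⇒antitone {f = f} step m≤n = go (≤⇒≤′ m≤n)
  where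
  go : ∀ {m n} → m ≤′ n → f n ≤ f m
  go ≤′-refl        = ≤-refl
  go (≤′-step m≤′n) = ≤-trans (step _) (go m≤′n)

superlevel-downClosed : f Preserves _≤_ ⟶ _≥_ → (λ j → k < f j) Respects _≥_
superlevel-downClosed antitone j′≤j k<fj = <-≤-trans k<fj (antitone j′≤j)

conj : ℕ → (ℕ → ℕ) → ℕ → ℕ
conj n f k = count n (λ j → k <? f j)

conj-≤ : ∀ n f k → conj n f k ≤ n
conj-≤ n f k = count-≤ n (λ j → k <? f j)

conj-antitone : ∀ n f → conj n f Preserves _≤_ ⟶ _≥_
conj-antitone n f k≤k′ = count-mono n _ _ (λ _ → ≤-<-trans k≤k′)

conj-mono : ∀ n k → (∀ j → f j ≤ g j) → conj n f k ≤ conj n g k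
conj-mono n k f≤g = count-mono n _ _ (λ {j} _ k<fj → <-≤-trans k<fj (f≤g j))

conj-cong : ∀ n k → (∀ j → f j ≡ g j) → conj n f k ≡ conj n g k
conj-cong n k f≡g =
  ≤-antisym (conj-mono n k (≤-reflexive ∘ f≡g)) (conj-mono n k (≤-reflexive ∘ sym ∘ f≡g))

conj-vanishes : ∀ n k → (∀ j → f j ≤ k) → conj n f k ≡ 0
conj-vanishes n k f≤k = count-none n _ (λ {j} _ → ≤⇒≯ (f≤k j))

<-conj : ∀ n k → f Preserves _≤_ ⟶ _≥_ → j < n → j < conj n f k ⇔ k < f j
<-conj {f = f} n k antitone =
  count-downClosed n (λ j → k <? f j) (superlevel-downClosed antitone)

conj-involutive : ∀ n m → f Preserves _≤_ ⟶ _≥_ → (∀ {j} → n ≤ j → f j ≡ 0) →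
                  (∀ j → f j ≤ m) → ∀ k → conj m (conj n f) k ≡ f k
conj-involutive {f = f} n m antitone vanishes f≤m k = begin
  conj m (conj n f) k   ≡⟨ count-cong m (λ j → k <? conj n f j) (_<? f k) transpose ⟩
  count m (_<? f k)     ≡⟨ count-< (f≤m k) ⟩
  f k                   ∎
  where
  open ≡-Reasoning
  transpose : ∀ {j} → j < m → k < conj n f j ⇔ j < f k
  transpose {j} _ with k <? n
  ... | yes k<n = <-conj n j antitone k<n
  ... | no  k≮n = mk⇔ (λ k<conj → contradiction (<-≤-trans k<conj (conj-≤ n f j)) k≮n)
                      (λ j<fk → contradiction (subst (j <_) (vanishes (≮⇒≥ k≮n)) j<fk) λ ())

conj-step : ∀ n k → f Preserves _≤_ ⟶ _≥_ → g Preserves _≤_ ⟶ _≥_ → (∀ j → g j ≤ f j) →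
            conj n f k ≡
            count n (λ j → (f j ≟ suc k) ×-dec (g j <? suc k)) + (conj n g k ⊔ conj n f (suc k))
conj-step {f = f} {g = g} n k f-antitone g-antitone g≤f = begin
  conj n f k
    ≡⟨ count-split n P? (Q? ∪? R?) ⟩
  count n (P? ∩? ∁? (Q? ∪? R?)) + count n (P? ∩? (Q? ∪? R?))
    ≡⟨ cong₂ _+_ (count-cong n _ S? (λ _ → exactly))
                 (count-cong n _ (Q? ∪? R?) (λ _ → inside)) ⟩
  count n S? + count n (Q? ∪? R?)
    ≡⟨ cong (count n S? +_) (count-∪ n Q? R? (superlevel-downClosed g-antitone)
                                             (superlevel-downClosed f-antitone)) ⟩
  count n S? + (conj n g k ⊔ conj n f (suc k))
    ∎
  where
  open ≡-Reasoning
  P? : Decidable (λ j → k < f j)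
  P? j = k <? f j
  Q? : Decidable (λ j → k < g j)
  Q? j = k <? g j
  R? : Decidable (λ j → suc k < f j)
  R? j = suc k <? f j
  S? : Decidable (λ j → f j ≡ suc k × g j < suc k)
  S? j = (f j ≟ suc k) ×-dec (g j <? suc k)
  exactly : ∀ {j} → (k < f j × ¬ (k < g j ⊎ suc k < f j)) ⇔ (f j ≡ suc k × g j < suc k)
  exactly = mk⇔
    (λ (k<fj , ¬Q∪R) → ≤-antisym (≮⇒≥ (¬Q∪R ∘ inj₂)) k<fj , s≤s (≮⇒≥ (¬Q∪R ∘ inj₁)))
    (λ (fj≡1+k , gj≤k) →
      ≤-reflexive (sym fj≡1+k) , [ ≤⇒≯ (s≤s⁻¹ gj≤k) , <-irrefl (sym fj≡1+k) ])
  inside : ∀ {j} → (k < f j × (k < g j ⊎ suc k < f j)) ⇔ (k < g j ⊎ suc k < f j)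
  inside {j} = mk⇔ proj₂ (λ Q∪R → [ (λ k<gj → <-≤-trans k<gj (g≤f j)) , <⇒≤ ] Q∪R , Q∪R)

-- Last passage times

dropRow dropCol : (ℕ → ℕ → ℕ) → ℕ → ℕ → ℕ
dropRow F i k = F (suc i) k
dropCol F i k = F i (suc k)

-- M i k is the last passage time from (i, k) to the corner (b-1, c-1) for the weights E.
record LastPassage (b c : ℕ) (E M : ℕ → ℕ → ℕ) : Set where
  field
    recurrence : ∀ {i k} → i < b → k < c → M i k ≡ E i k + (M (suc i) k ⊔ M i (suc k))
    vanishᵇ    : ∀ {i k} → b ≤ i → M i k ≡ 0
    vanishᶜ    : ∀ {i k} → c ≤ k → M i k ≡ 0

open LastPassage

LastPassage-dropRow : LastPassage (suc b) c E M → LastPassage b c (dropRow E) (dropRow M)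
LastPassage-dropRow lp = record
  { recurrence = λ i<b → recurrence lp (s≤s i<b)
  ; vanishᵇ    = λ b≤i → vanishᵇ lp (s≤s b≤i)
  ; vanishᶜ    = vanishᶜ lp
  }

LastPassage-dropCol : LastPassage b (suc c) E M → LastPassage b c (dropCol E) (dropCol M)
LastPassage-dropCol lp = record
  { recurrence = λ i<b k<c → recurrence lp i<b (s≤s k<c)
  ; vanishᵇ    = vanishᵇ lp
  ; vanishᶜ    = λ c≤k → vanishᶜ lp (s≤s c≤k)
  }

lastPassage-unique : ∀ {N} → LastPassage b c E M → LastPassage b c E N → ∀ i k → M i k ≡ N i k
lastPassage-unique {zero}          lp lp′ i k = trans (vanishᵇ lp z≤n) (sym (vanishᵇ lp′ z≤n))
lastPassage-unique {suc b} {zero}  lp lp′ i k = trans (vanishᶜ lp z≤n) (sym (vanishᶜ lp′ z≤n))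
lastPassage-unique {suc b} {suc c} {E} {M} {N} lp lp′ = agree
  where
  agree-dropRow : ∀ i k → M (suc i) k ≡ N (suc i) k
  agree-dropRow = lastPassage-unique (LastPassage-dropRow lp) (LastPassage-dropRow lp′)
  agree-dropCol : ∀ i k → M i (suc k) ≡ N i (suc k)
  agree-dropCol = lastPassage-unique (LastPassage-dropCol lp) (LastPassage-dropCol lp′)
  agree : ∀ i k → M i k ≡ N i k
  agree (suc i) k       = agree-dropRow i k
  agree zero    (suc k) = agree-dropCol 0 k
  agree zero    zero    = begin
    M 0 0                     ≡⟨ recurrence lp z<s z<s ⟩
    E 0 0 + (M 1 0 ⊔ M 0 1)   ≡⟨ cong (E 0 0 +_) (cong₂ _⊔_ (agree-dropRow 0 0)
                                                             (agree-dropCol 0 0)) ⟩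
    E 0 0 + (N 1 0 ⊔ N 0 1)   ≡⟨ sym (recurrence lp′ z<s z<s) ⟩
    N 0 0                     ∎
    where open ≡-Reasoning

lastPassage-weights-unique : ∀ {E′ N} → LastPassage b c E M → LastPassage b c E′ N →
                             (∀ i k → M i k ≡ N i k) → i < b → k < c → E i k ≡ E′ i k
lastPassage-weights-unique {E = E} {M = M} {i = i} {k = k} {E′ = E′} {N = N}
                           lp lp′ M≡N i<b k<c =
  +-cancelʳ-≡ (M (suc i) k ⊔ M i (suc k)) (E i k) (E′ i k) (begin
    E i k + (M (suc i) k ⊔ M i (suc k))    ≡⟨ sym (recurrence lp i<b k<c) ⟩
    M i k                                  ≡⟨ M≡N i k ⟩
    N i k                                  ≡⟨ recurrence lp′ i<b k<c ⟩
    E′ i k + (N (suc i) k ⊔ N i (suc k))   ≡⟨ cong (E′ i k +_) (sym (cong₂ _⊔_ (M≡N (suc i) k)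
                                                                          (M≡N i (suc k)))) ⟩
    E′ i k + (M (suc i) k ⊔ M i (suc k))   ∎)
  where open ≡-Reasoning

n≡0⇒n≤m : ∀ {n m} → n ≡ 0 → n ≤ m
n≡0⇒n≤m refl = z≤n

lastPassage-rowStep : LastPassage b c E M → ∀ i k → M (suc i) k ≤ M i k
lastPassage-rowStep {b} {c} {E} {M} lp i k with i <? b | k <? c
... | yes i<b | yes k<c = ≤-trans (≤-trans (m≤m⊔n _ _) (m≤n+m _ (E i k)))
                                  (≤-reflexive (sym (recurrence lp i<b k<c)))
... | no i≮b  | _       = n≡0⇒n≤m (vanishᵇ lp (m≤n⇒m≤1+n (≮⇒≥ i≮b)))
... | yes _   | no k≮c  = n≡0⇒n≤m (vanishᶜ lp (≮⇒≥ k≮c))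

lastPassage-colStep : LastPassage b c E M → ∀ i k → M i (suc k) ≤ M i k
lastPassage-colStep {b} {c} {E} {M} lp i k with i <? b | k <? c
... | yes i<b | yes k<c = ≤-trans (≤-trans (m≤n⊔m _ _) (m≤n+m _ (E i k)))
                                  (≤-reflexive (sym (recurrence lp i<b k<c)))
... | no i≮b  | _       = n≡0⇒n≤m (vanishᵇ lp (≮⇒≥ i≮b))
... | yes _   | no k≮c  = n≡0⇒n≤m (vanishᶜ lp (m≤n⇒m≤1+n (≮⇒≥ k≮c)))

lastPassage-antitone : LastPassage b c E M → ∀ i → M i Preserves _≤_ ⟶ _≥_
lastPassage-antitone lp i = steps⇒antitone (lastPassage-colStep lp i)

lastPassage-≤-origin : LastPassage b c E M → ∀ i k → M i k ≤ M 0 0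
lastPassage-≤-origin {M = M} lp i k =
  ≤-trans (steps⇒antitone {f = λ i → M i k} (λ i → lastPassage-rowStep lp i k) z≤n)
          (lastPassage-antitone lp 0 z≤n)

G : ℕ → ℕ → (ℕ → ℕ → ℕ) → ℕ
G zero    s       E = 0
G (suc r) zero    E = 0
G (suc r) (suc s) E = E 0 0 + (G r (suc s) (dropRow E) ⊔ G (suc r) s (dropCol E))

G-cong : ∀ r s {F} → (∀ i k → E i k ≡ F i k) → G r s E ≡ G r s F
G-cong zero    s       E≡F = refl
G-cong (suc r) zero    E≡F = refl
G-cong (suc r) (suc s) E≡F =
  cong₂ _+_ (E≡F 0 0) (cong₂ _⊔_ (G-cong r (suc s) (λ i k → E≡F (suc i) k))
                                 (G-cong (suc r) s (λ i k → E≡F i (suc k))))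

G-zeroʳ : ∀ r → G r 0 E ≡ 0
G-zeroʳ zero    = refl
G-zeroʳ (suc r) = refl

weight-≤-G : ∀ {r s} (path : Path r s) → weight E path ≤ G (suc r) (suc s) E
weight-≤-G {E} stop         = m≤m+n (E 0 0) 0
weight-≤-G {E} (down path)  = +-monoʳ-≤ (E 0 0) (≤-trans (weight-≤-G path) (m≤m⊔n _ _))
weight-≤-G {E} (right path) = +-monoʳ-≤ (E 0 0) (≤-trans (weight-≤-G path) (m≤n⊔m _ _))

G-attained : ∀ r s E → ∃ λ (path : Path r s) → weight E path ≡ G (suc r) (suc s) E
G-attained zero    zero    E = stop , sym (+-identityʳ (E 0 0))
G-attained (suc r) zero    E =
  let path , w≡ = G-attained r zero (dropRow E)
  in down path , cong (E 0 0 +_) (trans w≡ (sym (⊔-identityʳ _)))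
G-attained zero    (suc s) E =
  let path , w≡ = G-attained zero s (dropCol E)
  in right path , cong (E 0 0 +_) w≡
G-attained (suc r) (suc s) E
  with ⊔-sel (G (suc r) (suc (suc s)) (dropRow E)) (G (suc (suc r)) (suc s) (dropCol E))
... | inj₁ ⊔≡down =
  let path , w≡ = G-attained r (suc s) (dropRow E)
  in down path , cong (E 0 0 +_) (trans w≡ (sym ⊔≡down))
... | inj₂ ⊔≡right =
  let path , w≡ = G-attained (suc r) s (dropCol E)
  in right path , cong (E 0 0 +_) (trans w≡ (sym ⊔≡right))

-- Indices are shifted as x + i, not i + x, so that shift E i k 0 0 reduces to E i k.
shift : (ℕ → ℕ → ℕ) → ℕ → ℕ → ℕ → ℕ → ℕ
shift E i k x y = E (x + i) (y + k)

Gfrom : ℕ → ℕ → (ℕ → ℕ → ℕ) → ℕ → ℕ → ℕ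
Gfrom b c E i k = G (b ∸ i) (c ∸ k) (shift E i k)

m>n⇒m∸n≡1+[m∸1+n] : i < b → b ∸ i ≡ suc (b ∸ suc i)
m>n⇒m∸n≡1+[m∸1+n] (s≤s i≤b) = +-∸-assoc 1 i≤b

Gfrom-lastPassage : ∀ b c E → LastPassage b c E (Gfrom b c E)
Gfrom-lastPassage b c E = record
  { recurrence = recurrence′
  ; vanishᵇ    = λ {i} {k} → vanishᵇ′ {i} {k}
  ; vanishᶜ    = λ {i} {k} → vanishᶜ′ {i} {k}
  }
  where
  recurrence′ : ∀ {i k} → i < b → k < c →
                Gfrom b c E i k ≡ E i k + (Gfrom b c E (suc i) k ⊔ Gfrom b c E i (suc k))
  recurrence′ {i} {k} i<b k<c rewrite m>n⇒m∸n≡1+[m∸1+n] i<b | m>n⇒m∸n≡1+[m∸1+n] k<c =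
    cong (E i k +_) (cong₂ _⊔_
      (G-cong (b ∸ suc i) (suc (c ∸ suc k)) {shift E (suc i) k}
              (λ x y → cong (λ z → E z (y + k)) (sym (+-suc x i))))
      (G-cong (suc (b ∸ suc i)) (c ∸ suc k) {shift E i (suc k)}
              (λ x y → cong (E (x + i)) (sym (+-suc y k)))))
  vanishᵇ′ : ∀ {i k} → b ≤ i → Gfrom b c E i k ≡ 0
  vanishᵇ′ b≤i rewrite m≤n⇒m∸n≡0 b≤i = refl
  vanishᶜ′ : ∀ {i k} → c ≤ k → Gfrom b c E i k ≡ 0
  vanishᶜ′ {i} c≤k rewrite m≤n⇒m∸n≡0 c≤k = G-zeroʳ (b ∸ i)

Gfrom-origin : ∀ b c E → Gfrom b c E 0 0 ≡ G b c E
Gfrom-origin b c E = G-cong b c (λ x y → cong₂ E (+-identityʳ x) (+-identityʳ y))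

lastPassage-G : LastPassage b c E M → M 0 0 ≡ G b c E
lastPassage-G {b} {c} {E} lp =
  trans (lastPassage-unique lp (Gfrom-lastPassage b c E) 0 0) (Gfrom-origin b c E)

-- Plane partitions and the widths of their level sets

ext-toℕ : ∀ (D : Matrix b c) I L → ext b c D (toℕ I) (toℕ L) ≡ D I L
ext-toℕ {b} {c} D I L with toℕ I <? b | toℕ L <? c
... | yes I<b | yes L<c = cong₂ D (fromℕ<-toℕ I I<b) (fromℕ<-toℕ L L<c)
... | no I≮b  | _       = contradiction (toℕ<n I) I≮b
... | yes _   | no L≮c  = contradiction (toℕ<n L) L≮c

ext-vanishᵇ : ∀ (D : Matrix b c) → b ≤ i → ext b c D i k ≡ 0
ext-vanishᵇ {b} {c} {i} {k} D b≤i with i <? b | k <? c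
... | yes i<b | yes _ = contradiction b≤i (<⇒≱ i<b)
... | yes _   | no _  = refl
... | no _    | _     = refl

ext-vanishᶜ : ∀ (D : Matrix b c) → c ≤ k → ext b c D i k ≡ 0
ext-vanishᶜ {b} {c} {k} {i} D c≤k with i <? b | k <? c
... | yes _ | yes k<c = contradiction c≤k (<⇒≱ k<c)
... | yes _ | no _    = refl
... | no _  | _       = refl

below-ext : ∀ (π : Array a b) I j → below a b π I j ≡ ext b a π (suc (toℕ I)) (toℕ j)
below-ext {a} {b} π I j with suc (toℕ I) <? b | toℕ j <? a
... | yes _ | yes j<a = cong (π _) (sym (fromℕ<-toℕ j j<a))
... | yes _ | no j≮a  = contradiction (toℕ<n j) j≮a
... | no _  | _       = refl

lastPassage-ext : ∀ (D : Matrix b c) →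
                  (∀ I L → M (toℕ I) (toℕ L) ≡
                           D I L + (M (suc (toℕ I)) (toℕ L) ⊔ M (toℕ I) (suc (toℕ L)))) →
                  (∀ {i k} → b ≤ i → M i k ≡ 0) → (∀ {i k} → c ≤ k → M i k ≡ 0) →
                  LastPassage b c (ext b c D) M
lastPassage-ext {b} {c} {M} D recurrence-Fin vanishᵇ vanishᶜ = record
  { recurrence = recurrence-ℕ
  ; vanishᵇ    = vanishᵇ
  ; vanishᶜ    = vanishᶜ
  }
  where
  Recurrence : ℕ → ℕ → Set
  Recurrence i k = M i k ≡ ext b c D i k + (M (suc i) k ⊔ M i (suc k))
  recurrence-ℕ : ∀ {i k} → i < b → k < c → Recurrence i k
  recurrence-ℕ i<b k<c = subst₂ Recurrence (toℕ-fromℕ< i<b) (toℕ-fromℕ< k<c)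
    (trans (recurrence-Fin I L) (cong₂ _+_ (sym (ext-toℕ D I L)) refl))
    where
    I : Fin b
    I = fromℕ< i<b
    L : Fin c
    L = fromℕ< k<c

module PlanePartition {a b c} {π : Array a b} (pp : IsPP a b c π) where

  entry-≤ : ∀ i j → ext b a π i j ≤ c
  entry-≤ i j with i <? b | j <? a
  ... | yes _ | yes _ = proj₁ pp _ _
  ... | yes _ | no _  = z≤n
  ... | no _  | _     = z≤n

  entry-colStep : ∀ i j → ext b a π (suc i) j ≤ ext b a π i j
  entry-colStep i j with suc i <? b | i <? b | j <? a
  ... | yes 1+i<b | yes i<b | yes _ =
    proj₁ (proj₂ pp) _ _ _ (trans (toℕ-fromℕ< 1+i<b) (cong suc (sym (toℕ-fromℕ< i<b))))
  ... | yes 1+i<b | no i≮b  | _     = contradiction (<-trans (n<1+n i) 1+i<b) i≮b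
  ... | yes _     | _       | no _  = z≤n
  ... | no _      | _       | _     = z≤n

  entry-rowStep : ∀ i j → ext b a π i (suc j) ≤ ext b a π i j
  entry-rowStep i j with i <? b | suc j <? a | j <? a
  ... | yes _ | yes 1+j<a | yes j<a =
    proj₂ (proj₂ pp) _ _ _ (trans (toℕ-fromℕ< 1+j<a) (cong suc (sym (toℕ-fromℕ< j<a))))
  ... | yes _ | yes 1+j<a | no j≮a  = contradiction (<-trans (n<1+n j) 1+j<a) j≮a
  ... | yes _ | no _      | _       = z≤n
  ... | no _  | _         | _       = z≤n

  entry-antitone : ∀ i → ext b a π i Preserves _≤_ ⟶ _≥_
  entry-antitone i = steps⇒antitone (entry-rowStep i)

length-filter-tabulate : ∀ {A : Set} {R : Pred A p} (R? : Decidable R) (h : Fin n → A)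
                         (P? : Decidable P) → (∀ j → does (R? (h j)) ≡ does (P? (toℕ j))) →
                         length (filter R? (tabulate h)) ≡ count n P?
length-filter-tabulate {n = zero}  R? h P? agree = refl
length-filter-tabulate {n = suc n} R? h P? agree
  with R? (h Fin.zero) | P? 0 | agree Fin.zero
... | yes _ | yes _ | _ =
  cong suc (length-filter-tabulate R? (h ∘ Fin.suc) (P? ∘ suc) (agree ∘ Fin.suc))
... | no _  | no _  | _ = length-filter-tabulate R? (h ∘ Fin.suc) (P? ∘ suc) (agree ∘ Fin.suc)
... | yes _ | no _  | ()
... | no _  | yes _ | ()

levelWidth : Array a b → ℕ → ℕ → ℕ
levelWidth {a} {b} π i = conj a (ext b a π i)

Φ-count : ∀ (π : Array a b) I L →
          Φ a b c π I L ≡ count a (λ j → (ext b a π (toℕ I) j ≟ suc (toℕ L))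
                                          ×-dec (ext b a π (suc (toℕ I)) j <? suc (toℕ L)))
Φ-count π I L = length-filter-tabulate _ (λ j → j) _ λ j →
  cong₂ (λ x y → does ((x ≟ suc (toℕ L)) ×-dec (y <? suc (toℕ L))))
        (sym (ext-toℕ π I j)) (below-ext π I j)

levelWidth-recurrence : ∀ {π : Array a b} → IsPP a b c π → ∀ I L →
                        levelWidth π (toℕ I) (toℕ L) ≡
                        Φ a b c π I L + (levelWidth π (suc (toℕ I)) (toℕ L) ⊔
                                         levelWidth π (toℕ I) (suc (toℕ L)))
levelWidth-recurrence {a} {π = π} pp I L =
  trans (conj-step a (toℕ L) (entry-antitone (toℕ I)) (entry-antitone (suc (toℕ I)))
                   (entry-colStep (toℕ I)))
        (cong₂ _+_ (sym (Φ-count π I L)) refl)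
  where open PlanePartition pp

levelWidth-lastPassage : ∀ {π : Array a b} {D : Matrix b c} → IsPP a b c π →
                         (∀ I L → Φ a b c π I L ≡ D I L) →
                         LastPassage b c (ext b c D) (levelWidth π)
levelWidth-lastPassage {a} {π = π} {D} pp Φ≡D = lastPassage-ext D
  (λ I L → trans (levelWidth-recurrence pp I L) (cong₂ _+_ (Φ≡D I L) refl))
  (λ b≤i → conj-vanishes a _ (λ j → n≡0⇒n≤m (ext-vanishᵇ π b≤i)))
  (λ {i} c≤k → conj-vanishes a _ (λ j → ≤-trans (entry-≤ i j) c≤k))
  where open PlanePartition pp

entry-levelWidth : ∀ {π : Array a b} → IsPP a b c π →
                   ∀ i j → ext b a π i j ≡ conj c (levelWidth π i) j
entry-levelWidth {a} {c = c} {π} pp i j =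
  sym (conj-involutive a c (entry-antitone i) (ext-vanishᶜ π) (entry-≤ i) j)
  where open PlanePartition pp

fromWidths : ℕ → (ℕ → ℕ → ℕ) → Array a b
fromWidths c M I j = conj c (M (toℕ I)) (toℕ j)

fromWidths-IsPP : (∀ i k → M (suc i) k ≤ M i k) → IsPP a b c (fromWidths c M)
fromWidths-IsPP {M = M} {c = c} rowStep =
  (λ I j → conj-≤ c _ (toℕ j)) ,
  (λ I I′ j I′≡1+I → subst (λ i′ → conj c (M i′) (toℕ j) ≤ conj c (M (toℕ I)) (toℕ j))
                           (sym I′≡1+I) (conj-mono c (toℕ j) (rowStep (toℕ I)))) ,
  (λ I j j′ j′≡1+j → conj-antitone c _ (subst (toℕ j ≤_) (sym j′≡1+j) (n≤1+n (toℕ j))))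

ext-fromWidths : LastPassage b c E M → M 0 0 ≤ a →
                 ∀ i j → ext b a (fromWidths c M) i j ≡ conj c (M i) j
ext-fromWidths {b} {c} {M = M} {a} lp M₀₀≤a i j with i <? b | j <? a
... | yes i<b | yes j<a = cong₂ (λ i′ j′ → conj c (M i′) j′) (toℕ-fromℕ< i<b) (toℕ-fromℕ< j<a)
... | yes _   | no j≮a  = sym (conj-vanishes c j λ k →
                            ≤-trans (lastPassage-≤-origin lp i k) (≤-trans M₀₀≤a (≮⇒≥ j≮a)))
... | no i≮b  | _       = sym (conj-vanishes c j λ k → n≡0⇒n≤m (vanishᵇ lp (≮⇒≥ i≮b)))

levelWidth-fromWidths : LastPassage b c E M → M 0 0 ≤ a →
                        ∀ i k → levelWidth {a} {b} (fromWidths c M) i k ≡ M i k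
levelWidth-fromWidths {b} {c} {M = M} {a} lp M₀₀≤a i k = trans
  (conj-cong a k (ext-fromWidths lp M₀₀≤a i))
  (conj-involutive c a (lastPassage-antitone lp i) (vanishᶜ lp)
                   (λ k → ≤-trans (lastPassage-≤-origin lp i k) M₀₀≤a) k)

Φ-bounded : ∀ {π : Array a (suc b)} → IsPP a (suc b) (suc c) π →
            IsBM a (suc b) (suc c) (Φ a (suc b) (suc c) π)
Φ-bounded {a} {b} {c} {π} pp path = begin
  weight weights path          ≤⟨ weight-≤-G path ⟩
  G (suc b) (suc c) weights    ≡⟨ sym (lastPassage-G (levelWidth-lastPassage pp (λ _ _ → refl))) ⟩
  levelWidth π 0 0             ≤⟨ conj-≤ a _ 0 ⟩
  a                            ∎
  where
  open ≤-Reasoning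
  weights : ℕ → ℕ → ℕ
  weights = ext (suc b) (suc c) (Φ a (suc b) (suc c) π)

Φ-injective : ∀ {π π′ : Array a b} → IsPP a b c π → IsPP a b c π′ →
              (∀ I L → Φ a b c π I L ≡ Φ a b c π′ I L) → ∀ I j → π I j ≡ π′ I j
Φ-injective {a} {b} {c} {π} {π′} pp pp′ Φ≡Φ′ I j = begin
  π I j                                    ≡⟨ sym (ext-toℕ π I j) ⟩
  ext b a π (toℕ I) (toℕ j)                ≡⟨ entry-levelWidth pp (toℕ I) (toℕ j) ⟩
  conj c (levelWidth π (toℕ I)) (toℕ j)    ≡⟨ conj-cong c (toℕ j) (same-widths (toℕ I)) ⟩
  conj c (levelWidth π′ (toℕ I)) (toℕ j)   ≡⟨ sym (entry-levelWidth pp′ (toℕ I) (toℕ j)) ⟩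
  ext b a π′ (toℕ I) (toℕ j)               ≡⟨ ext-toℕ π′ I j ⟩
  π′ I j                                   ∎
  where
  open ≡-Reasoning
  same-widths : ∀ i k → levelWidth π i k ≡ levelWidth π′ i k
  same-widths = lastPassage-unique (levelWidth-lastPassage pp (λ _ _ → refl))
                                   (levelWidth-lastPassage pp′ (λ I L → sym (Φ≡Φ′ I L)))

Φ-surjective : ∀ {D : Matrix (suc b) (suc c)} → IsBM a (suc b) (suc c) D →
               ∃ λ (π : Array a (suc b)) →
                 IsPP a (suc b) (suc c) π × (∀ I L → Φ a (suc b) (suc c) π I L ≡ D I L)
Φ-surjective {b} {c} {a} {D} bounded = π , π-IsPP , Φ≡D
  where
  weights widths : ℕ → ℕ → ℕ
  weights = ext (suc b) (suc c) D
  widths  = Gfrom (suc b) (suc c) weights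
  lp : LastPassage (suc b) (suc c) weights widths
  lp = Gfrom-lastPassage (suc b) (suc c) weights
  widths₀₀≤a : widths 0 0 ≤ a
  widths₀₀≤a = let path , w≡ = G-attained b c weights in begin
    widths 0 0                 ≡⟨ lastPassage-G lp ⟩
    G (suc b) (suc c) weights  ≡⟨ sym w≡ ⟩
    weight weights path        ≤⟨ bounded path ⟩
    a                          ∎
    where open ≤-Reasoning
  π : Array a (suc b)
  π = fromWidths (suc c) widths
  π-IsPP : IsPP a (suc b) (suc c) π
  π-IsPP = fromWidths-IsPP (lastPassage-rowStep lp)
  Φ≡D : ∀ I L → Φ a (suc b) (suc c) π I L ≡ D I L
  Φ≡D I L = begin
    Φ a (suc b) (suc c) π I L
      ≡⟨ sym (ext-toℕ _ I L) ⟩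
    ext (suc b) (suc c) (Φ a (suc b) (suc c) π) (toℕ I) (toℕ L)
      ≡⟨ lastPassage-weights-unique (levelWidth-lastPassage π-IsPP (λ _ _ → refl)) lp
           (levelWidth-fromWidths lp widths₀₀≤a) (toℕ<n I) (toℕ<n L) ⟩
    weights (toℕ I) (toℕ L)
      ≡⟨ ext-toℕ D I L ⟩
    D I L
      ∎
    where open ≡-Reasoning

theorem2p2 : (a b c : ℕ) → 0 < a → 0 < b → 0 < c →
    ((π : Array a b) → IsPP a b c π → IsBM a b c (Φ a b c π))
    × ((π π' : Array a b) → IsPP a b c π → IsPP a b c π' →
        (∀ i ℓ → Φ a b c π i ℓ ≡ Φ a b c π' i ℓ) → ∀ i j → π i j ≡ π' i j)
    × ((D : Matrix b c) → IsBM a b c D →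
        ∃ λ (π : Array a b) → IsPP a b c π × (∀ i ℓ → Φ a b c π i ℓ ≡ D i ℓ))
theorem2p2 a zero    c       _ () _
theorem2p2 a (suc b) zero    _ _  ()
theorem2p2 a (suc b) (suc c) _ _  _  =
  (λ π → Φ-bounded) , (λ π π′ → Φ-injective) , (λ D → Φ-surjective)
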